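{- Let $k\ge 2$ be an integer and $n=\lceil\log_2 k\rceil+1$ (the minimum size of a set admitting a separating family of $k$ arbitrary bipartitions). The number of separating families of $k$ arbitrary bipartitions for an $n$-element set is $\binom{2^{\lceil\log_2 k\rceil}}{k}$.
   Context: A bipartition of a set $S$ is a partition of $S$ into at most two nonempty components (so the trivial partition $\{S\}$ is a bipartition). A bipartition cuts two elements if they lie in different components. A family of (distinct) bipartitions of $S$ is a separating family for $S$ if every two distinct elements of $S$ are cut by some bipartition in the family. -}

module Defs where

open import Data.Nat using (ℕ; zero; suc)
open import Data.Bool using (Bool)
open import Data.Fin using (Fin)
open import Data.Fin.Subset using (Subset; outside)
open import Data.Vec using (lookup)
open import Data.List using (List; length)
open import Data.List.Relation.Unary.All using (All)
open import Data.List.Relation.Unary.Any using (Any)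
open import Data.List.Relation.Unary.AllPairs using (AllPairs)
open import Data.List.Relation.Unary.Unique.Propositional using (Unique)
open import Data.List.Relation.Binary.Permutation.Propositional using (_↭_)
open import Data.Product using (Σ; Σ-syntax; ∃; _×_; _,_)
open import Relation.Binary.PropositionalEquality using (_≡_; _≢_)
open import Relation.Nullary using (¬_)

-- A bipartition of the (suc m)-element set Fin (suc m) is {A, complement of A}
-- (the trivial partition corresponds to A = ∅).  We represent it canonically by
-- the component A NOT containing the element zero, i.e. A is the set of
-- elements that lie in a different component from zero.  This is a bijection
-- between bipartitions of Fin (suc m) and such subsets A.
Bipartition : ℕ → Set
Bipartition m = Σ[ A ∈ Subset (suc m) ] (lookup A Fin.zero ≡ outside)

Cuts : ∀ {m} → Bipartition m → Fin (suc m) → Fin (suc m) → Set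
Cuts (A , _) i j = lookup A i ≢ lookup A j

-- A family of bipartitions is a list of pairwise distinct bipartitions;
-- two families are the same family iff the lists are permutations of each other.
Separating : ∀ {m} → List (Bipartition m) → Set
Separating {m} F = (i j : Fin (suc m)) → i ≢ j → Any (λ b → Cuts b i j) F

IsSepFamily : (m k : ℕ) → List (Bipartition m) → Set
IsSepFamily m k F = Unique F × length F ≡ k × Separating F

NumSepFamilies≡ : (m k c : ℕ) → Set
NumSepFamilies≡ m k c =
  ∃ λ (L : List (List (Bipartition m))) →
    length L ≡ c
    × All (IsSepFamily m k) L
    × AllPairs (λ F G → ¬ (F ↭ G)) L
    × ((F : List (Bipartition m)) → IsSepFamily m k F → Any (F ↭_) L)

-- Put m = ⌈log₂ k⌉, so that 2 ^ (m - 1) < k ≤ 2 ^ m, and fix an element o of the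
-- (m + 1)-element set; a bipartition is determined by which of the other m elements
-- lie on the far side from o, so there are exactly 2 ^ m of them. Any k distinct
-- bipartitions already separate: if none of them cut two elements j ≠ i, moving i to
-- the other side is an injection from the family into bipartitions that do cut j and i,
-- i.e. into the complement of the family, forcing 2k ≤ 2 ^ m. Hence the separating
-- families are exactly the k-subsets of the 2 ^ m bipartitions.
module Submission where

open import Defs
open import Data.Nat using (ℕ; _≤_; _^_)
open import Data.Nat.Logarithm using (⌈log₂_⌉)
open import Data.Nat.Combinatorics using (_C_)

open import Level using (Level)
open import Function using (_∘_; id)
open import Data.Nat using (zero; suc; _+_; _*_; _<_; z≤n; s≤s)
open import Data.Nat.Properties
  using (≤-trans; ≰⇒>; <⇒≱; 1+n≰n; *-monoʳ-≤; *-monoʳ-<; +-identityʳ; suc-injective; module ≤-Reasoning)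
open import Data.Nat.Logarithm using (⌈log₂⌉-mono-≤; ⌈log₂2^n⌉≡n)
open import Data.Nat.Combinatorics using (nCk+nC[k+1]≡[n+1]C[k+1])
open import Data.Bool using (not) renaming (_≟_ to _≟ᵇ_)
open import Data.Bool.Properties using (not-¬; not-involutive)
open import Data.Fin using (Fin; zero; suc)
open import Data.Fin.Subset using (Subset; inside; outside)
open import Data.Vec using ([]; _∷_; lookup; updateAt)
open import Data.Vec.Properties
  using (∷-injectiveʳ; ≡-dec; lookup∘updateAt; lookup∘updateAt′; updateAt-updateAt-local; updateAt-id)
open import Data.List using (List; []; _∷_; [_]; _++_; map; length)
open import Data.List.Properties using (length-++; length-map)
open import Data.List.Membership.Propositional using (_∈_)
open import Data.List.Membership.Propositional.Properties using (∈-∃++; ∈-map⁺; ∈-map⁻; ∈-++⁺ˡ; ∈-++⁺ʳ; ∈-++⁻)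
open import Data.List.Membership.DecPropositional using (_∈?_)
open import Data.List.Relation.Unary.All as All using (All; []; _∷_)
open import Data.List.Relation.Unary.All.Properties using (All¬⇒¬Any; ¬Any⇒All¬)
open import Data.List.Relation.Unary.Any as Any using (Any; here; there; any?)
open import Data.List.Relation.Unary.Any.Properties using (++⁺ˡ; ++⁺ʳ; map⁺)
open import Data.List.Relation.Unary.AllPairs as AllPairs using (AllPairs; []; _∷_)
import Data.List.Relation.Unary.AllPairs.Properties as AllPairsₚ
open import Data.List.Relation.Unary.Unique.Propositional using (Unique)
import Data.List.Relation.Unary.Unique.Propositional.Properties as Unique
open import Data.List.Relation.Binary.Disjoint.Propositional using (Disjoint)
open import Data.List.Relation.Binary.Subset.Propositional using (_⊆_)
open import Data.List.Relation.Binary.Subset.Propositional.Properties using (⊆-respʳ-↭; ⊆∷∧∉⇒⊆; ∷⊈[]; ∷⁺ʳ; All-resp-⊇)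
open import Data.List.Relation.Binary.Permutation.Propositional using (_↭_; ↭-refl; ↭-prep; ↭-trans; ↭-sym; ↭⇒↭ₛ)
open import Data.List.Relation.Binary.Permutation.Propositional.Properties using (∈-resp-↭; ↭-length; shift; drop-∷)
import Data.List.Relation.Binary.Permutation.Setoid.Properties as PermutationSetoid
open import Data.Product using (∃; _×_; _,_; proj₁)
open import Data.Sum as Sum using (_⊎_; inj₁; inj₂)
open import Data.Empty using (⊥-elim)
open import Relation.Nullary using (¬_; Dec; yes; no)
open import Relation.Nullary.Decidable as Dec using (¬?)
open import Relation.Binary.Definitions using (DecidableEquality)
open import Relation.Binary.PropositionalEquality
  using (_≡_; _≢_; refl; sym; trans; cong; cong₂; subst; ≢-sym; setoid; module ≡-Reasoning)

private
  variable
    a : Level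
    A : Set a
    m : ℕ
    x : A
    xs ys F G : List A

Unique-resp-↭ : xs ↭ ys → Unique xs → Unique ys
Unique-resp-↭ σ = PermutationSetoid.Unique-resp-↭ (setoid _) (↭⇒↭ₛ σ)

Unique∧⊆⇒length≤ : Unique xs → xs ⊆ ys → length xs ≤ length ys
Unique∧⊆⇒length≤ [] _ = z≤n
Unique∧⊆⇒length≤ {xs = x ∷ xs} (x∉xs ∷ u) xs⊆ys
  with ws , zs , refl ← ∈-∃++ (xs⊆ys (here refl)) = begin
    suc (length xs)       ≤⟨ s≤s (Unique∧⊆⇒length≤ u xs⊆ws++zs) ⟩
    length (x ∷ ws ++ zs) ≡⟨ ↭-length (↭-sym σ) ⟩
    length (ws ++ x ∷ zs) ∎
  where
  open ≤-Reasoning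
  σ = shift x ws zs
  xs⊆ws++zs : xs ⊆ ws ++ zs
  xs⊆ws++zs = ⊆∷∧∉⇒⊆ (⊆-respʳ-↭ σ (xs⊆ys ∘ there)) (All¬⇒¬Any x∉xs)

combinations : ℕ → List A → List (List A)
combinations zero    xs       = [ [] ]
combinations (suc k) []       = []
combinations (suc k) (x ∷ xs) = map (x ∷_) (combinations k xs) ++ combinations (suc k) xs

length-combinations : ∀ k (xs : List A) → length (combinations k xs) ≡ length xs C k
length-combinations zero    xs       = refl
length-combinations (suc k) []       = refl
length-combinations (suc k) (x ∷ xs) = begin
  length (map (x ∷_) (combinations k xs) ++ combinations (suc k) xs)
    ≡⟨ length-++ (map (x ∷_) (combinations k xs)) ⟩
  length (map (x ∷_) (combinations k xs)) + length (combinations (suc k) xs)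
    ≡⟨ cong₂ _+_ (trans (length-map _ (combinations k xs)) (length-combinations k xs))
                 (length-combinations (suc k) xs) ⟩
  length xs C k + length xs C suc k
    ≡⟨ nCk+nC[k+1]≡[n+1]C[k+1] (length xs) k ⟩
  suc (length xs) C suc k ∎
  where open ≡-Reasoning

∈-combinations⁻ : ∀ k x (xs : List A) → G ∈ combinations (suc k) (x ∷ xs) →
                  (∃ λ G′ → G′ ∈ combinations k xs × G ≡ x ∷ G′) ⊎ G ∈ combinations (suc k) xs
∈-combinations⁻ k x xs = Sum.map₁ (∈-map⁻ (x ∷_)) ∘ ∈-++⁻ (map (x ∷_) (combinations k xs))

combinations-length : ∀ k (xs : List A) → G ∈ combinations k xs → length G ≡ k
combinations-length zero    xs       (here refl) = refl
combinations-length (suc k) (x ∷ xs) G∈ with ∈-combinations⁻ k x xs G∈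
... | inj₁ (G′ , G′∈ , refl) = cong suc (combinations-length k xs G′∈)
... | inj₂ G∈′              = combinations-length (suc k) xs G∈′

combinations-⊆ : ∀ k (xs : List A) → G ∈ combinations k xs → G ⊆ xs
combinations-⊆ zero    xs       (here refl) ()
combinations-⊆ (suc k) (x ∷ xs) G∈ with ∈-combinations⁻ k x xs G∈
... | inj₁ (G′ , G′∈ , refl) = ∷⁺ʳ x (combinations-⊆ k xs G′∈)
... | inj₂ G∈′              = there ∘ combinations-⊆ (suc k) xs G∈′

combinations-Unique : ∀ k (xs : List A) → Unique xs → G ∈ combinations k xs → Unique G
combinations-Unique zero    xs       _          (here refl) = []
combinations-Unique (suc k) (x ∷ xs) (x∉xs ∷ u) G∈ with ∈-combinations⁻ k x xs G∈
... | inj₁ (G′ , G′∈ , refl) = All-resp-⊇ (combinations-⊆ k xs G′∈) x∉xs ∷ combinations-Unique k xs u G′∈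
... | inj₂ G∈′              = combinations-Unique (suc k) xs u G∈′

combinations-↭-distinct : ∀ k (xs : List A) → Unique xs →
                          AllPairs (λ F G → ¬ (F ↭ G)) (combinations k xs)
combinations-↭-distinct zero    xs       _          = [] ∷ []
combinations-↭-distinct (suc k) []       _          = []
combinations-↭-distinct (suc k) (x ∷ xs) (x∉xs ∷ u) =
  AllPairsₚ.++⁺ (AllPairsₚ.map⁺ (AllPairs.map (_∘ drop-∷) (combinations-↭-distinct k xs u)))
                (combinations-↭-distinct (suc k) xs u)
                (All.tabulate λ F∈ → All.tabulate λ G∈ → ¬↭-across F∈ G∈)
  where
  -- Every member of the left block contains x, no member of the right block does.
  ¬↭-across : F ∈ map (x ∷_) (combinations k xs) → G ∈ combinations (suc k) xs → ¬ (F ↭ G)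
  ¬↭-across F∈ G∈ σ with _ , _ , refl ← ∈-map⁻ (x ∷_) F∈ =
    All¬⇒¬Any x∉xs (combinations-⊆ (suc k) xs G∈ (∈-resp-↭ σ (here refl)))

combinations-complete : DecidableEquality A → ∀ k (xs : List A) {F : List A} →
                        Unique F → length F ≡ k → F ⊆ xs → Any (F ↭_) (combinations k xs)
combinations-complete _≟_ zero    xs       {[]}    _ _  _    = here ↭-refl
combinations-complete _≟_ (suc k) []       {_ ∷ _} _ _  F⊆[] = ⊥-elim (∷⊈[] F⊆[])
combinations-complete _≟_ (suc k) (x ∷ xs) {F}     u |F| F⊆ with _∈?_ _≟_ x F
... | no x∉F = ++⁺ʳ _ (combinations-complete _≟_ (suc k) xs u |F| (⊆∷∧∉⇒⊆ F⊆ x∉F))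
... | yes x∈F with ys , zs , refl ← ∈-∃++ x∈F =
  ++⁺ˡ (map⁺ (Any.map (λ τ → ↭-trans σ (↭-prep x τ)) rest))
  where
  σ = shift x ys zs
  u′ = Unique-resp-↭ σ u
  rest : Any (ys ++ zs ↭_) (combinations k xs)
  rest = combinations-complete _≟_ k xs (AllPairs.tail u′)
           (suc-injective (trans (sym (↭-length σ)) |F|))
           (⊆∷∧∉⇒⊆ (F⊆ ∘ ∈-resp-↭ (↭-sym σ) ∘ there) (All¬⇒¬Any (AllPairs.head u′)))

⌈log₂n⌉≡1+l⇒2^l<n : ∀ {n l} → ⌈log₂ n ⌉ ≡ suc l → 2 ^ l < n
⌈log₂n⌉≡1+l⇒2^l<n {n} {l} eq = ≰⇒> λ n≤2^l → 1+n≰n (begin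
  suc l           ≡⟨ sym eq ⟩
  ⌈log₂ n ⌉       ≤⟨ ⌈log₂⌉-mono-≤ n≤2^l ⟩
  ⌈log₂ (2 ^ l) ⌉ ≡⟨ ⌈log₂2^n⌉≡n l ⟩
  l               ∎)
  where open ≤-Reasoning

2^⌈log₂n⌉<2n : ∀ {n} → 0 < n → 2 ^ ⌈log₂ n ⌉ < 2 * n
2^⌈log₂n⌉<2n {n} 0<n with ⌈log₂ n ⌉ in eq
... | zero  = *-monoʳ-≤ 2 0<n
... | suc l = *-monoʳ-< 2 (⌈log₂n⌉≡1+l⇒2^l<n {n} eq)

allSubsets : ∀ m → List (Subset m)
allSubsets zero    = [ [] ]
allSubsets (suc m) = map (inside ∷_) (allSubsets m) ++ map (outside ∷_) (allSubsets m)

length-allSubsets : ∀ m → length (allSubsets m) ≡ 2 ^ m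
length-allSubsets zero    = refl
length-allSubsets (suc m) = begin
  length (map (inside ∷_) S ++ map (outside ∷_) S)         ≡⟨ length-++ (map (inside ∷_) S) ⟩
  length (map (inside ∷_) S) + length (map (outside ∷_) S) ≡⟨ cong₂ _+_ (length-map _ S) (length-map _ S) ⟩
  length S + length S                                      ≡⟨ cong (λ l → l + l) (length-allSubsets m) ⟩
  2 ^ m + 2 ^ m                                            ≡⟨ cong (2 ^ m +_) (sym (+-identityʳ (2 ^ m))) ⟩
  2 ^ suc m                                                ∎
  where
  open ≡-Reasoning
  S = allSubsets m

∈-allSubsets : (p : Subset m) → p ∈ allSubsets m
∈-allSubsets []            = here refl
∈-allSubsets (inside ∷ p)  = ∈-++⁺ˡ (∈-map⁺ (inside ∷_) (∈-allSubsets p))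
∈-allSubsets (outside ∷ p) = ∈-++⁺ʳ _ (∈-map⁺ (outside ∷_) (∈-allSubsets p))

allSubsets-Unique : ∀ m → Unique (allSubsets m)
allSubsets-Unique zero    = [] ∷ []
allSubsets-Unique (suc m) =
  Unique.++⁺ (Unique.map⁺ ∷-injectiveʳ (allSubsets-Unique m))
             (Unique.map⁺ ∷-injectiveʳ (allSubsets-Unique m))
             disjoint
  where
  disjoint : Disjoint (map (inside ∷_) (allSubsets m)) (map (outside ∷_) (allSubsets m))
  disjoint (p∈ , p∈′) with ∈-map⁻ _ p∈ | ∈-map⁻ _ p∈′
  ... | _ , _ , refl | _ , _ , ()

toBipartition : Subset m → Bipartition m
toBipartition p = outside ∷ p , refl

toBipartition-injective : ∀ {p q : Subset m} → toBipartition p ≡ toBipartition q → p ≡ q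
toBipartition-injective = ∷-injectiveʳ ∘ cong proj₁

bipartitions : ∀ m → List (Bipartition m)
bipartitions m = map toBipartition (allSubsets m)

length-bipartitions : ∀ m → length (bipartitions m) ≡ 2 ^ m
length-bipartitions m = trans (length-map toBipartition (allSubsets m)) (length-allSubsets m)

∈-bipartitions : (b : Bipartition m) → b ∈ bipartitions m
∈-bipartitions (outside ∷ p , refl) = ∈-map⁺ toBipartition (∈-allSubsets p)

⊆-bipartitions : {F : List (Bipartition m)} → F ⊆ bipartitions m
⊆-bipartitions {x = b} _ = ∈-bipartitions b

bipartitions-Unique : ∀ m → Unique (bipartitions m)
bipartitions-Unique m = Unique.map⁺ toBipartition-injective (allSubsets-Unique m)

_≟_ : DecidableEquality (Bipartition m)
(outside ∷ p , refl) ≟ (outside ∷ q , refl) =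
  Dec.map′ (cong toBipartition) toBipartition-injective (≡-dec _≟ᵇ_ p q)

-- toggle i moves the element suc i to the other component.
toggle : Fin m → Bipartition m → Bipartition m
toggle i (a ∷ p , a≡outside) = a ∷ updateAt p i not , a≡outside

toggle-involutive : ∀ (i : Fin m) b → toggle i (toggle i b) ≡ b
toggle-involutive i (a ∷ p , a≡outside) = cong (λ p′ → a ∷ p′ , a≡outside)
  (trans (updateAt-updateAt-local i {h = id} p (not-involutive (lookup p i))) (updateAt-id i p))

toggle-injective : ∀ {i : Fin m} {b c} → toggle i b ≡ toggle i c → b ≡ c
toggle-injective {i = i} {b} {c} eq =
  trans (sym (toggle-involutive i b)) (trans (cong (toggle i) eq) (toggle-involutive i c))

toggle-lookup-self : ∀ (i : Fin m) b →
                     lookup (proj₁ (toggle i b)) (suc i) ≡ not (lookup (proj₁ b) (suc i))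
toggle-lookup-self i (a ∷ p , _) = lookup∘updateAt i p

toggle-lookup-other : ∀ {o} (i : Fin m) b → o ≢ suc i →
                      lookup (proj₁ (toggle i b)) o ≡ lookup (proj₁ b) o
toggle-lookup-other {o = zero}  i (a ∷ p , _) _   = refl
toggle-lookup-other {o = suc j} i (a ∷ p , _) j≢i = lookup∘updateAt′ j i (j≢i ∘ cong suc) p

toggle-cuts : ∀ {o} (i : Fin m) b → o ≢ suc i → ¬ Cuts b o (suc i) → Cuts (toggle i b) o (suc i)
toggle-cuts i b o≢ uncut same′ = uncut λ same →
  not-¬ same (trans (sym (toggle-lookup-other i b o≢)) (trans same′ (toggle-lookup-self i b)))

-- toggle i sends F to bipartitions that do cut o from suc i, hence disjointly from F.
uncut⇒2*length≤2^m : ∀ {o} {i : Fin m} {F} → Unique F → o ≢ suc i →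
                     All (λ b → ¬ Cuts b o (suc i)) F → 2 * length F ≤ 2 ^ m
uncut⇒2*length≤2^m {m} {o} {i} {F} u o≢ uncut = begin
  2 * length F                         ≡⟨ cong (length F +_) (+-identityʳ (length F)) ⟩
  length F + length F                  ≡⟨ cong (length F +_) (sym (length-map (toggle i) F)) ⟩
  length F + length (map (toggle i) F) ≡⟨ sym (length-++ F) ⟩
  length (F ++ map (toggle i) F)       ≤⟨ Unique∧⊆⇒length≤ unique ⊆-bipartitions ⟩
  length (bipartitions m)              ≡⟨ length-bipartitions m ⟩
  2 ^ m                                ∎
  where
  open ≤-Reasoning
  disjoint : Disjoint F (map (toggle i) F)
  disjoint (b∈F , b∈F′) with c , c∈F , refl ← ∈-map⁻ (toggle i) b∈F′ =
    All.lookup uncut b∈F (toggle-cuts i c o≢ (All.lookup uncut c∈F))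
  unique : Unique (F ++ map (toggle i) F)
  unique = Unique.++⁺ u (Unique.map⁺ toggle-injective u) disjoint

cuts? : ∀ (i j : Fin (suc m)) b → Dec (Cuts b i j)
cuts? i j (A , _) = ¬? (lookup A i ≟ᵇ lookup A j)

Unique∧2^m<2*length⇒Separating : ∀ {F : List (Bipartition m)} → Unique F →
                                 2 ^ m < 2 * length F → Separating F
Unique∧2^m<2*length⇒Separating {F = F} u 2^m<2|F| i j i≢j with any? (cuts? i j) F
... | yes cut = cut
... | no ¬cut = ⊥-elim (uncut-pair-impossible i j i≢j (¬Any⇒All¬ F ¬cut))
  where
  uncut-impossible : ∀ o i → o ≢ suc i → ¬ All (λ b → ¬ Cuts b o (suc i)) F
  uncut-impossible o i o≢ uncut = <⇒≱ 2^m<2|F| (uncut⇒2*length≤2^m u o≢ uncut)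
  uncut-pair-impossible : ∀ i j → i ≢ j → ¬ All (λ b → ¬ Cuts b i j) F
  uncut-pair-impossible zero    zero    i≢j _     = i≢j refl
  uncut-pair-impossible i       (suc j) i≢j uncut = uncut-impossible i j i≢j uncut
  uncut-pair-impossible (suc i) zero    i≢j uncut =
    uncut-impossible zero i (≢-sym i≢j) (All.map (_∘ ≢-sym) uncut)

proposition3p18 : (k : ℕ) → 2 ≤ k →
    NumSepFamilies≡ ⌈log₂ k ⌉ k ((2 ^ ⌈log₂ k ⌉) C k)
proposition3p18 k 2≤k =
    combinations k Ω
  , trans (length-combinations k Ω) (cong (_C k) (length-bipartitions L))
  , All.tabulate isSepFamily
  , combinations-↭-distinct k Ω (bipartitions-Unique L)
  , λ F (uF , |F| , _) → combinations-complete _≟_ k Ω uF |F| ⊆-bipartitions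
  where
  L = ⌈log₂ k ⌉
  Ω = bipartitions L
  isSepFamily : ∀ {F} → F ∈ combinations k Ω → IsSepFamily L k F
  isSepFamily {F} F∈ =
    uF , |F| , Unique∧2^m<2*length⇒Separating uF (subst (λ l → 2 ^ L < 2 * l) (sym |F|) 2^L<2k)
    where
    uF = combinations-Unique k Ω (bipartitions-Unique L) F∈
    |F| = combinations-length k Ω F∈
    2^L<2k = 2^⌈log₂n⌉<2n (≤-trans (s≤s z≤n) 2≤k)
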